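{- There is an absolute constant $c>0$ such that for all integers $2\le m\le n$ and every $m\times n$ matrix $A$ whose entries are $1,\dots,mn$ (each exactly once), the total number of column rotations performed by procedure FillColumns on input $A$ is at most $c\cdot mn$.
   Context: Rows and columns are numbered from $1$. For $x\in\{1,\dots,mn\}$ let $\mathrm{row}(x)=\lceil x/n\rceil$ and $\mathrm{col}(x)=((x-1)\bmod n)+1$ (its target row and target column). $R$ denotes the first row and $C_j$ the $j$-th column; $R[j]$ and $C_j[i]$ denote the position (or the element in it) at column $j$ of $R$, respectively at row $i$ of $C_j$; so $R[j]=C_j[1]$. "Rotate $R$" means a unit rightward rotation of the first row: the element in $R[j]$ moves to $R[j+1]$ for $j<n$ and the element in $R[n]$ moves to $R[1]$. "Rotate $C_j$" means a unit downward rotation of column $j$: $C_j[i]$ moves to $C_j[i+1]$ for $i<m$ and $C_j[m]$ moves to $C_j[1]$. The body of $C_j$ consists of positions $C_j[2],\dots,C_j[m]$. A column $C_j$ is near-full if every element $x$ in its body has $\mathrm{col}(x)=j$, and underfull otherwise. Procedure FillColumns: while there exists an underfull column, do the following (one iteration of the outer loop): for $j=1,2,\dots,n$ in order, while $\mathrm{col}(R[j])=j$ and $C_j$ is underfull, rotate $C_j$; after the for-loop, rotate $R$ once. -}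

module Defs where

open import Data.Nat using (ℕ; zero; suc; _+_; _*_; _∸_; _≤_; _≡ᵇ_; _≤ᵇ_)
open import Data.Nat.DivMod using (_%_)
open import Data.Bool using (Bool; true; false; if_then_else_; _∧_; not)
open import Data.List using (List; map; upTo)
open import Data.Bool.ListAction using (all; any)
open import Data.Maybe using (Maybe; just; nothing)
open import Data.Product using (_×_; ∃-syntax)
open import Relation.Binary.PropositionalEquality using (_≡_)

-- An m×n matrix with 1-based indices: entry at row i, column j is A i j
-- (only 1 ≤ i ≤ m, 1 ≤ j ≤ n are meaningful).
Matrix : Set
Matrix = ℕ → ℕ → ℕ

range : ℕ → ℕ → List ℕ
range a b = map (a +_) (upTo (suc b ∸ a))

-- target column col(x) = ((x-1) mod n) + 1   (n ≥ 1; value for n = 0 irrelevant)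
colOf : ℕ → ℕ → ℕ
colOf zero    x = 0
colOf (suc k) x = suc ((x ∸ 1) % suc k)

rotCol : ℕ → ℕ → Matrix → Matrix
rotCol m j A i j' =
  if j' ≡ᵇ j
  then (if i ≡ᵇ 1 then A m j
        else if (2 ≤ᵇ i) ∧ (i ≤ᵇ m) then A (i ∸ 1) j
        else A i j)
  else A i j'

rotRow : ℕ → Matrix → Matrix
rotRow n A i j =
  if i ≡ᵇ 1
  then (if j ≡ᵇ 1 then A 1 n
        else if (2 ≤ᵇ j) ∧ (j ≤ᵇ n) then A 1 (j ∸ 1)
        else A 1 j)
  else A i j

nearFull : ℕ → ℕ → Matrix → ℕ → Bool
nearFull m n A j = all (λ i → colOf n (A i j) ≡ᵇ j) (range 2 m)

underfull : ℕ → ℕ → Matrix → ℕ → Bool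
underfull m n A j = not (nearFull m n A j)

someUnderfull : ℕ → ℕ → Matrix → Bool
someUnderfull m n A = any (underfull m n A) (range 1 n)

-- Machine state of FillColumns:
--   pc = 0        : about to test the outer while-condition
--   1 ≤ pc ≤ n    : inside the for-loop, at column j = pc
--   pc = n + 1    : after the for-loop, about to rotate R
-- rots counts the column rotations performed so far.
record State : Set where
  constructor st
  field
    mat  : Matrix
    pc   : ℕ
    rots : ℕ
open State public

-- one atomic step; nothing = the procedure has halted
step : ℕ → ℕ → State → Maybe State
step m n (st A zero r) =
  if someUnderfull m n A then just (st A 1 r) else nothing
step m n (st A (suc p) r) =
  if suc p ≤ᵇ n
  then (if (colOf n (A 1 (suc p)) ≡ᵇ suc p) ∧ underfull m n A (suc p)
        then just (st (rotCol m (suc p) A) (suc p) (suc r))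
        else just (st A (suc (suc p)) r))
  else just (st (rotRow n A) 0 r)

run : ℕ → ℕ → ℕ → State → State
run m n zero    s = s
run m n (suc k) s with step m n s
... | just s' = run m n k s'
... | nothing = s

initial : Matrix → State
initial A = st A 0 0

IsEntryPerm : ℕ → ℕ → Matrix → Set
IsEntryPerm m n A =
  (∀ i j → 1 ≤ i → i ≤ m → 1 ≤ j → j ≤ n → 1 ≤ A i j × A i j ≤ m * n)
  × (∀ i j i' j' → 1 ≤ i → i ≤ m → 1 ≤ j → j ≤ n
                 → 1 ≤ i' → i' ≤ m → 1 ≤ j' → j' ≤ n
                 → A i j ≡ A i' j' → i ≡ i' × j ≡ j')
  × (∀ x → 1 ≤ x → x ≤ m * n →
       ∃[ i ] ∃[ j ] (1 ≤ i × i ≤ m × 1 ≤ j × j ≤ n × A i j ≡ x))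

-- Let the filled depth of a column C_j be the number of leading positions
-- C_j[2], C_j[3], … of its body whose elements x satisfy col(x) = j.  Rotating
-- the first row leaves every body untouched.  FillColumns rotates C_j only when
-- col(R[j]) = j and C_j is underfull; the rotation pushes R[j] onto the top of
-- the body and drops C_j[m], which lies below the first misplaced body element,
-- so the filled depth of C_j grows by exactly one.  Hence the number of column
-- rotations never exceeds the sum of the filled depths, which is at most
-- (m - 1) n.  Neither m ≤ n nor the entries being a permutation is needed.
module Submission where

open import Defs
open import Data.Nat using (ℕ; zero; suc; _+_; _*_; _≤_; _<_; _≡ᵇ_; _≤ᵇ_; z≤n; s≤s)
open import Data.Nat.Properties
open import Data.Bool using (Bool; true; false)
open import Data.Bool.Properties using (T-≡; not-injective)
open import Data.Bool.ListAction using (and)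
open import Data.List using (List; []; _∷_; _∷ʳ_; length; map; applyUpTo)
open import Data.Nat.ListAction using (sum)
open import Data.List.Properties using (applyUpTo-∷ʳ; length-applyUpTo; map-upTo; map-applyUpTo)
open import Data.Maybe using (just; nothing)
open import Data.Product using (∃-syntax; _,_)
open import Function using (_∘_; Equivalence)
open import Relation.Nullary.Decidable using (dec-true; dec-false)
open import Relation.Binary.PropositionalEquality

leadingTrues : List Bool → ℕ
leadingTrues []           = 0
leadingTrues (true  ∷ bs) = suc (leadingTrues bs)
leadingTrues (false ∷ bs) = 0

leadingTrues-≤-length : ∀ bs → leadingTrues bs ≤ length bs
leadingTrues-≤-length []           = z≤n
leadingTrues-≤-length (true  ∷ bs) = s≤s (leadingTrues-≤-length bs)
leadingTrues-≤-length (false ∷ bs) = z≤n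

leadingTrues-∷ʳ : ∀ bs b → and (bs ∷ʳ b) ≡ false → leadingTrues (bs ∷ʳ b) ≡ leadingTrues bs
leadingTrues-∷ʳ []           false _         = refl
leadingTrues-∷ʳ (true  ∷ bs) b     misplaced = cong suc (leadingTrues-∷ʳ bs b misplaced)
leadingTrues-∷ʳ (false ∷ bs) b     _         = refl

applyUpTo-cong : ∀ {A : Set} {f g : ℕ → A} n → (∀ t → t < n → f t ≡ g t) →
                 applyUpTo f n ≡ applyUpTo g n
applyUpTo-cong zero    _  = refl
applyUpTo-cong (suc n) eq = cong₂ _∷_ (eq 0 (s≤s z≤n)) (applyUpTo-cong n (λ t t<n → eq (suc t) (s≤s t<n)))

sum-applyUpTo-≤ : ∀ {f : ℕ → ℕ} {b} n → (∀ t → f t ≤ b) → sum (applyUpTo f n) ≤ n * b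
sum-applyUpTo-≤ zero    _   = z≤n
sum-applyUpTo-≤ (suc n) f≤b = +-mono-≤ (f≤b 0) (sum-applyUpTo-≤ n (λ t → f≤b (suc t)))

sum-applyUpTo-suc : ∀ {f g : ℕ → ℕ} n i → i < n → g i ≡ suc (f i) → (∀ t → t ≢ i → g t ≡ f t) →
                    sum (applyUpTo g n) ≡ suc (sum (applyUpTo f n))
sum-applyUpTo-suc (suc n) zero _ gi≡1+fi rest =
  cong₂ _+_ gi≡1+fi (cong sum (applyUpTo-cong n (λ t _ → rest (suc t) λ ())))
sum-applyUpTo-suc {f} (suc n) (suc i) (s≤s i<n) gi≡1+fi rest =
  trans (cong₂ _+_ (rest 0 λ ()) (sum-applyUpTo-suc n i i<n gi≡1+fi (λ t t≢i → rest (suc t) (t≢i ∘ suc-injective))))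
        (+-suc (f 0) _)

rotCol-other : ∀ m j A i {j'} → j' ≢ j → rotCol m j A i j' ≡ A i j'
rotCol-other m j A i {j'} j'≢j rewrite dec-false (j' ≟ j) j'≢j = refl

rotCol-body : ∀ m j A i → 2 + i ≤ m → rotCol m j A (2 + i) j ≡ A (1 + i) j
rotCol-body m j A i 2+i≤m rewrite dec-true (j ≟ j) refl | dec-true (2 + i ≤? m) 2+i≤m = refl

module FilledDepth (k n : ℕ) where

  m : ℕ
  m = 2 + k

  inTargetCol : Matrix → ℕ → ℕ → Bool
  inTargetCol A i j = colOf n (A i j) ≡ᵇ j

  bodyInTargetCol : Matrix → ℕ → List Bool
  bodyInTargetCol A j = applyUpTo (λ t → inTargetCol A (2 + t) j) (suc k)

  filledDepth : Matrix → ℕ → ℕ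
  filledDepth A j = leadingTrues (bodyInTargetCol A j)

  Φ : Matrix → ℕ
  Φ A = sum (applyUpTo (λ t → filledDepth A (suc t)) n)

  Φ-≤ : ∀ A → Φ A ≤ m * n
  Φ-≤ A = begin
    Φ A            ≤⟨ sum-applyUpTo-≤ n (λ t → filledDepth-≤ (suc t)) ⟩
    n * suc k      ≤⟨ *-monoʳ-≤ n (n≤1+n (suc k)) ⟩
    n * m          ≡⟨ *-comm n m ⟩
    m * n          ∎
    where
      open ≤-Reasoning
      filledDepth-≤ : ∀ j → filledDepth A j ≤ suc k
      filledDepth-≤ j = subst (filledDepth A j ≤_) (length-applyUpTo (λ t → inTargetCol A (2 + t) j) (suc k))
                              (leadingTrues-≤-length (bodyInTargetCol A j))

  nearFull-bodyInTargetCol : ∀ A j → nearFull m n A j ≡ and (bodyInTargetCol A j)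
  nearFull-bodyInTargetCol A j = cong and (trans (cong (map (λ i → inTargetCol A i j)) (map-upTo (2 +_) (suc k)))
                                                 (map-applyUpTo (2 +_) (λ i → inTargetCol A i j) (suc k)))

  filledDepth-rotCol : ∀ A j → inTargetCol A 1 j ≡ true → underfull m n A j ≡ true →
                       filledDepth (rotCol m j A) j ≡ suc (filledDepth A j)
  filledDepth-rotCol A j top underfull = begin
    leadingTrues (bodyInTargetCol (rotCol m j A) j)  ≡⟨ cong leadingTrues shifted ⟩
    suc (leadingTrues upper)                         ≡⟨ cong suc (leadingTrues-∷ʳ upper bottom misplaced) ⟨
    suc (leadingTrues (upper ∷ʳ bottom))             ≡⟨ cong (suc ∘ leadingTrues) (applyUpTo-∷ʳ _ k) ⟩
    suc (filledDepth A j)                            ∎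
    where
      open ≡-Reasoning
      upper : List Bool
      upper = applyUpTo (λ t → inTargetCol A (2 + t) j) k
      bottom : Bool
      bottom = inTargetCol A (2 + k) j
      shifted : bodyInTargetCol (rotCol m j A) j ≡ true ∷ upper
      shifted = cong₂ _∷_ (trans (cong (λ x → colOf n x ≡ᵇ j) (rotCol-body m j A 0 (s≤s (s≤s z≤n)))) top)
                          (applyUpTo-cong k λ t t<k → cong (λ x → colOf n x ≡ᵇ j) (rotCol-body m j A (suc t) (s≤s (s≤s t<k))))
      misplaced : and (upper ∷ʳ bottom) ≡ false
      misplaced = begin
        and (upper ∷ʳ bottom)    ≡⟨ cong and (applyUpTo-∷ʳ _ k) ⟩
        and (bodyInTargetCol A j) ≡⟨ nearFull-bodyInTargetCol A j ⟨
        nearFull m n A j          ≡⟨ not-injective underfull ⟩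
        false                     ∎

  Φ-rotRow : ∀ A → Φ (rotRow n A) ≡ Φ A
  Φ-rotRow A = refl

  Φ-rotCol : ∀ A p → p < n → inTargetCol A 1 (suc p) ≡ true → underfull m n A (suc p) ≡ true →
             Φ (rotCol m (suc p) A) ≡ suc (Φ A)
  Φ-rotCol A p p<n top underfull =
    sum-applyUpTo-suc n p p<n (filledDepth-rotCol A (suc p) top underfull)
      (λ t t≢p → cong leadingTrues (applyUpTo-cong (suc k) λ i _ →
         cong (λ x → colOf n x ≡ᵇ suc t) (rotCol-other m (suc p) A (2 + i) (t≢p ∘ suc-injective))))

  RotsBounded : State → Set
  RotsBounded s = rots s ≤ Φ (mat s)

  step-RotsBounded : ∀ s {s'} → step m n s ≡ just s' → RotsBounded s → RotsBounded s'
  step-RotsBounded (st A zero r) e bounded with someUnderfull m n A | e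
  ... | true | refl = bounded
  step-RotsBounded (st A (suc p) r) e bounded with suc p ≤ᵇ n in 1+p≤ᵇn | e
  ... | false | refl = subst (r ≤_) (sym (Φ-rotRow A)) bounded
  ... | true | e′ with colOf n (A 1 (suc p)) ≡ᵇ suc p in top | underfull m n A (suc p) in uf | e′
  ...   | true  | true  | refl =
    subst (suc r ≤_) (sym (Φ-rotCol A p (≤ᵇ⇒≤ (suc p) n (Equivalence.from T-≡ 1+p≤ᵇn)) top uf)) (s≤s bounded)
  ...   | true  | false | refl = bounded
  ...   | false | _     | refl = bounded

  run-RotsBounded : ∀ K s → RotsBounded s → RotsBounded (run m n K s)
  run-RotsBounded zero    s bounded = bounded
  run-RotsBounded (suc K) s bounded with step m n s in e
  ... | just s' = run-RotsBounded K s' (step-RotsBounded s e bounded)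
  ... | nothing = bounded

  rots-run-≤ : ∀ A K → rots (run m n K (initial A)) ≤ m * n
  rots-run-≤ A K = ≤-trans (run-RotsBounded K (initial A) z≤n) (Φ-≤ (mat (run m n K (initial A))))

lemma2 : ∃[ c ] (∀ m n → 2 ≤ m → m ≤ n → (A : Matrix) → IsEntryPerm m n A →
           ∀ k → rots (run m n k (initial A)) ≤ c * (m * n))
lemma2 = 1 , λ where
  .(2 + k) n (s≤s (s≤s (z≤n {k}))) _ A _ K →
    subst (rots (run (2 + k) n K (initial A)) ≤_) (sym (*-identityˡ _)) (FilledDepth.rots-run-≤ k n A K)
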